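{- Let $p$ be a prime and let $\mathcal{C}_1\subset\mathcal{C}_2\subset\mathcal{C}_1^\perp$ be codes of length $n$ over $\mathbf{Z}_p$ with generator matrices $\begin{bmatrix} I_{k_1}&A\end{bmatrix}$ and $\begin{bmatrix} I_{k_1}&A\\0&B\end{bmatrix}$, where $A\in M_{k_1\times(n-k_1)}(\mathbf{Z})$, $B\in M_{k_2\times(n-k_1)}(\mathbf{Z})$, $\dim\mathcal{C}_1=k_1$, $\dim\mathcal{C}_2=k_1+k_2$; if $p=2$, assume $\mathcal{C}_1$ is doubly even. Let $X$ be the set of self-orthogonal codes $\mathcal{C}$ over $\mathbf{Z}_{p^2}$ of length $n$ with $\pi(\mathcal{C})=\iota^{ -1}(\mathcal{C})=\mathcal{C}_1$, and $X'$ the set of self-orthogonal codes $\mathcal{C}'$ over $\mathbf{Z}_{p^2}$ of length $n$ with $\pi(\mathcal{C}')=\mathcal{C}_1$ and $\iota^{ -1}(\mathcal{C}')=\mathcal{C}_2$. Then for every $\mathcal{C}\in X$ there exists a unique $\mathcal{C}'\in X'$ with $\mathcal{C}\subset\mathcal{C}'$.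
   Context: A code of length $n$ over $\mathbf{Z}_m$ is a $\mathbf{Z}_m$-submodule of $\mathbf{Z}_m^n$; an integer matrix $G\in M_{k\times n}(\mathbf{Z})$ is a generator matrix of $\mathcal{C}$ if $\mathcal{C}=\{aG\bmod m:a\in\mathbf{Z}^k\}$. Duals and self-orthogonality ($\mathcal{C}\subset\mathcal{C}^\perp$) refer to the standard inner product. $\pi:\mathbf{Z}_{p^2}^n\to\mathbf{Z}_p^n$ is reduction mod $p$ and $\iota:\mathbf{Z}_p^n\to\mathbf{Z}_{p^2}^n$ is $x\bmod p\mapsto px\bmod p^2$. A binary code is doubly even if all Hamming weights are divisible by $4$. -}

module Defs where

open import Level using (Level)
open import Data.Nat as ℕ using (ℕ; zero; suc; NonZero)
open import Data.Integer as ℤ using (ℤ; +_; _+_; _*_; _-_; _%ℕ_)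
open import Data.Integer.Divisibility using (_∣_)
import Data.Nat.Divisibility as ℕD
open import Data.Fin using (Fin; zero; suc; splitAt)
open import Data.Sum using (_⊎_; inj₁; inj₂; [_,_]′)
open import Data.Product using (Σ; _×_; _,_; ∃)
open import Function.Bundles using (_⇔_)
open import Relation.Nullary using (¬_; yes; no)
open import Relation.Binary.PropositionalEquality using (_≡_; subst)

-- Elements of Z_m are represented by integers, up to congruence mod m
-- (setoid presentation of the quotient Z → Z_m).
_≡[_]_ : ℤ → ℕ → ℤ → Set
x ≡[ m ] y = (+ m) ∣ (x - y)

Vect : ℕ → Set
Vect n = Fin n → ℤ

_≡v[_]_ : ∀ {n} → Vect n → ℕ → Vect n → Set
x ≡v[ m ] y = ∀ i → x i ≡[ m ] y i

0v : ∀ {n} → Vect n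
0v _ = + 0

_+v_ : ∀ {n} → Vect n → Vect n → Vect n
(x +v y) i = x i + y i

_·v_ : ∀ {n} → ℤ → Vect n → Vect n
(a ·v x) i = a * x i

sumFin : ∀ n → (Fin n → ℤ) → ℤ
sumFin zero    f = + 0
sumFin (suc n) f = f zero + sumFin n (λ i → f (suc i))

_∙_ : ∀ {n} → Vect n → Vect n → ℤ
_∙_ {n} x y = sumFin n (λ i → x i * y i)

_⊛_ : ∀ {k n} → (Fin k → ℤ) → (Fin k → Fin n → ℤ) → Vect n
_⊛_ {k} a G j = sumFin k (λ i → a i * G i j)

-- A code of length n over Z_m: a Z_m-submodule of Z_m^n
-- (membership predicate on representatives, invariant under congruence mod m).
record Code (m n : ℕ) : Set₁ where
  field
    _∈_     : Vect n → Set
    resp    : ∀ {x y} → x ≡v[ m ] y → _∈_ x → _∈_ y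
    zero∈   : _∈_ 0v
    +-closed : ∀ {x y} → _∈_ x → _∈_ y → _∈_ (x +v y)
    ·-closed : ∀ a {x} → _∈_ x → _∈_ (a ·v x)
open Code public

_∈ᶜ_ : ∀ {m n} → Vect n → Code m n → Set
x ∈ᶜ C = Code._∈_ C x

_⊆ᶜ_ : ∀ {m n} → Code m n → Code m n → Set
C ⊆ᶜ D = ∀ x → x ∈ᶜ C → x ∈ᶜ D

_≐ᶜ_ : ∀ {m n} → Code m n → Code m n → Set
C ≐ᶜ D = ∀ x → (x ∈ᶜ C) ⇔ (x ∈ᶜ D)

_∈⊥_ : ∀ {m n} → Vect n → Code m n → Set
_∈⊥_ {m} y C = ∀ x → x ∈ᶜ C → (x ∙ y) ≡[ m ] (+ 0)

_⊆⊥_ : ∀ {m n} → Code m n → Code m n → Set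
C ⊆⊥ D = ∀ x → x ∈ᶜ C → x ∈⊥ D

SelfOrthogonal : ∀ {m n} → Code m n → Set
SelfOrthogonal C = C ⊆⊥ C

IsGenerator : ∀ {m n k} → (Fin k → Fin n → ℤ) → Code m n → Set
IsGenerator {m} G C = ∀ x → (x ∈ᶜ C) ⇔ (∃ λ a → x ≡v[ m ] (a ⊛ G))

LinIndep : ∀ {k n} → ℕ → (Fin k → Fin n → ℤ) → Set
LinIndep m G = ∀ a → (a ⊛ G) ≡v[ m ] 0v → ∀ i → a i ≡[ m ] (+ 0)

HasDim : ∀ {p n} → Code p n → ℕ → Set
HasDim {p} {n} C k = Σ (Fin k → Vect n) λ b → IsGenerator b C × LinIndep p b

wt : ∀ {n} (m : ℕ) .{{_ : NonZero m}} → Vect n → ℕ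
wt {zero}  m x = 0
wt {suc n} m x with (x zero %ℕ m) ℕ.≟ 0
... | yes _ = wt m (λ i → x (suc i))
... | no  _ = suc (wt m (λ i → x (suc i)))

DoublyEven : ∀ {n} → Code 2 n → Set
DoublyEven C = ∀ x → x ∈ᶜ C → 4 ℕD.∣ wt 2 x

-- π : Z_{p²}^n → Z_p^n (reduction mod p); membership in π(C) for C over Z_{p²}
_∈π_ : ∀ {p n} → Vect n → Code (p ℕ.^ 2) n → Set
_∈π_ {p} x C = ∃ λ y → y ∈ᶜ C × x ≡v[ p ] y

-- ι : Z_p^n → Z_{p²}^n, x mod p ↦ p x mod p²; membership in ι⁻¹(C)
_∈ι⁻¹_ : ∀ {p n} → Vect n → Code (p ℕ.^ 2) n → Set
_∈ι⁻¹_ {p} x C = ((+ p) ·v x) ∈ᶜ C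

πEq : ∀ {p n} → Code (p ℕ.^ 2) n → Code p n → Set
πEq {p} C D = ∀ x → (_∈π_ {p} x C) ⇔ (x ∈ᶜ D)

ι⁻¹Eq : ∀ {p n} → Code (p ℕ.^ 2) n → Code p n → Set
ι⁻¹Eq {p} C D = ∀ x → (_∈ι⁻¹_ {p} x C) ⇔ (x ∈ᶜ D)

δ : ∀ {k} → Fin k → Fin k → ℤ
δ i j with i Data.Fin.≟ j
... | yes _ = + 1
... | no  _ = + 0

[I∣_] : ∀ {k₁ r} → (Fin k₁ → Fin r → ℤ) → Fin k₁ → Fin (k₁ ℕ.+ r) → ℤ
[I∣_] {k₁} A i j = [ δ i , A i ]′ (splitAt k₁ j)

[I∣_⁄0∣_] : ∀ {k₁ k₂ r} → (Fin k₁ → Fin r → ℤ) → (Fin k₂ → Fin r → ℤ)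
          → Fin (k₁ ℕ.+ k₂) → Fin (k₁ ℕ.+ r) → ℤ
[I∣_⁄0∣_] {k₁} A B i j =
  [ (λ i₁ → [I∣ A ] i₁ j) , (λ i₂ → [ (λ _ → + 0) , B i₂ ]′ (splitAt k₁ j)) ]′ (splitAt k₁ i)

InX : ∀ {p n} → Code p n → Code (p ℕ.^ 2) n → Set
InX C₁ C = SelfOrthogonal C × πEq C C₁ × ι⁻¹Eq C C₁

InX' : ∀ {p n} → Code p n → Code p n → Code (p ℕ.^ 2) n → Set
InX' C₁ C₂ C' = SelfOrthogonal C' × πEq C' C₁ × ι⁻¹Eq C' C₂

DoublyEvenIf2 : ∀ {p n} → Code p n → Set
DoublyEvenIf2 {p} {n} C = (e : p ≡ 2) → DoublyEven (subst (λ m → Code m n) e C)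

-- The lift is C′ = C + ι(C₂), the code generated by C and p·C₂. It is self-orthogonal
-- because p·C₂ pairs with itself into p²ℤ and with C into p·(C₁ · C₂) ⊆ p²ℤ; it reduces
-- mod p to π(C) = C₁ because p·C₂ vanishes mod p; and ι⁻¹(C′) = C₂ because ι⁻¹(C) = C₁ ⊆ C₂.
-- Conversely a code C″ ∈ X′ containing C contains ι(ι⁻¹ C″) = ι(C₂), and every x ∈ C″
-- agrees mod p with some c ∈ C (both reduce into C₁), so x − c ∈ ι(C₂) and C″ = C′.

module Submission where

open import Defs
open import Data.Nat using (ℕ; _^_)
import Data.Nat as ℕ
import Data.Nat.Properties as ℕₚ
open import Data.Nat.Primality using (Prime)
open import Data.Integer using (ℤ)
open import Data.Fin using (Fin; zero; suc)
open import Data.Product using (Σ; _×_; _,_; proj₁; proj₂; ∃; ∃₂)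
open import Function.Base using (_∘_)
open import Function.Bundles using (mk⇔; Equivalence)
open import Relation.Binary.Bundles using (Setoid)
open import Relation.Binary.Structures using (IsEquivalence)
open import Relation.Binary.PropositionalEquality
  using (_≡_; refl; sym; trans; cong; cong₂; subst; subst₂; module ≡-Reasoning)
import Relation.Binary.Reasoning.Setoid as SetoidReasoning

open Equivalence using (to; from)

module Congruence where
  open import Data.Integer using (+_; -_; _+_; _*_; _-_)
  import Data.Integer.Properties as ℤ
  open import Data.Integer.Divisibility.Signed
    using (_∣_; divides; ∣ᵤ⇒∣; ∣⇒∣ᵤ; ∣m∣n⇒∣m+n; ∣m⇒∣-m; ∣n⇒∣m*n; ∣m⇒∣m*n; *-monoʳ-∣)
  open import Data.Integer.Tactic.RingSolver using (solve-∀)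
  open import Algebra.Properties.Semiring.Sum ℤ.+-*-semiring
    using (sum; sum-cong-≗; ∑-distrib-+; *-distribˡ-sum)
  open import Algebra.Properties.CommutativeSemigroup ℤ.*-commutativeSemigroup
    using (x∙yz≈y∙xz)

  -- The relation _≡[_]_ wrapped in a record, so that x and y can be inferred from a proof.
  infix 4 _≈[_]_
  record _≈[_]_ (x : ℤ) (m : ℕ) (y : ℤ) : Set where
    constructor ≡[]⇒≈
    field ≈⇒≡[] : x ≡[ m ] y
  open _≈[_]_ public

  infix 4 _≈ᵛ[_]_
  _≈ᵛ[_]_ : ∀ {n} → Vect n → ℕ → Vect n → Set
  x ≈ᵛ[ m ] y = ∀ i → x i ≈[ m ] y i

  module _ {m : ℕ} where

    ∣⇒≈ : ∀ {x y} → + m ∣ x - y → x ≈[ m ] y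
    ∣⇒≈ = ≡[]⇒≈ ∘ ∣⇒∣ᵤ

    ≈⇒∣ : ∀ {x y} → x ≈[ m ] y → + m ∣ x - y
    ≈⇒∣ = ∣ᵤ⇒∣ ∘ ≈⇒≡[]

    ≈-reflexive : ∀ {x y} → x ≡ y → x ≈[ m ] y
    ≈-reflexive {x} refl = ∣⇒≈ (divides (+ 0) (ℤ.+-inverseʳ x))

    ≈-refl : ∀ {x} → x ≈[ m ] x
    ≈-refl = ≈-reflexive refl

    ≈-sym : ∀ {x y} → x ≈[ m ] y → y ≈[ m ] x
    ≈-sym {x} {y} x≈y = ∣⇒≈ (subst (+ m ∣_) (negate-diff x y) (∣m⇒∣-m (≈⇒∣ x≈y)))
      where
      negate-diff : ∀ x y → - (x - y) ≡ y - x
      negate-diff = solve-∀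

    ≈-trans : ∀ {x y z} → x ≈[ m ] y → y ≈[ m ] z → x ≈[ m ] z
    ≈-trans {x} {y} {z} x≈y y≈z =
      ∣⇒≈ (subst (+ m ∣_) (ℤ.+-minus-telescope x y z) (∣m∣n⇒∣m+n (≈⇒∣ x≈y) (≈⇒∣ y≈z)))

    ≈-isEquivalence : IsEquivalence (λ x y → x ≈[ m ] y)
    ≈-isEquivalence = record { refl = ≈-refl ; sym = ≈-sym ; trans = ≈-trans }

    ≈-setoid : Setoid _ _
    ≈-setoid = record { isEquivalence = ≈-isEquivalence }

    +-cong : ∀ {a b c d} → a ≈[ m ] b → c ≈[ m ] d → a + c ≈[ m ] b + d
    +-cong {a} {b} {c} {d} a≈b c≈d =
      ∣⇒≈ (subst (+ m ∣_) (interchange a b c d) (∣m∣n⇒∣m+n (≈⇒∣ a≈b) (≈⇒∣ c≈d)))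
      where
      interchange : ∀ a b c d → (a - b) + (c - d) ≡ (a + c) - (b + d)
      interchange = solve-∀

    -‿cong : ∀ {a b} → a ≈[ m ] b → - a ≈[ m ] - b
    -‿cong {a} {b} a≈b = ∣⇒≈ (subst (+ m ∣_) (negate-diff a b) (∣m⇒∣-m (≈⇒∣ a≈b)))
      where
      negate-diff : ∀ a b → - (a - b) ≡ - a - - b
      negate-diff = solve-∀

    *-cong : ∀ {a b c d} → a ≈[ m ] b → c ≈[ m ] d → a * c ≈[ m ] b * d
    *-cong {a} {b} {c} {d} a≈b c≈d =
      ∣⇒≈ (subst (+ m ∣_) (expand a b c d) (∣m∣n⇒∣m+n (∣n⇒∣m*n a (≈⇒∣ c≈d)) (∣m⇒∣m*n d (≈⇒∣ a≈b))))
      where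
      expand : ∀ a b c d → a * (c - d) + (a - b) * d ≡ a * c - b * d
      expand = solve-∀

    multiple≈0 : ∀ z → + m * z ≈[ m ] + 0
    multiple≈0 z = ∣⇒≈ (divides z (drop-0 (+ m) z))
      where
      drop-0 : ∀ k z → k * z - + 0 ≡ z * k
      drop-0 = solve-∀

    ≈⇒quotient : ∀ {x y} → x ≈[ m ] y → ∃ λ q → x ≡ y + + m * q
    ≈⇒quotient {x} {y} x≈y with ≈⇒∣ x≈y
    ... | divides q x-y≡q*m = q , (begin
      x                  ≡⟨ split x y ⟩
      y + (x - y)        ≡⟨ cong (_+_ y) x-y≡q*m ⟩
      y + q * + m        ≡⟨ cong (_+_ y) (ℤ.*-comm q (+ m)) ⟩
      y + + m * q        ∎)
      where
      open ≡-Reasoning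
      split : ∀ x y → x ≡ y + (x - y)
      split = solve-∀

  module ≈-Reasoning (m : ℕ) = SetoidReasoning (≈-setoid {m})

  +p²≡+p*+p : ∀ p → + (p ^ 2) ≡ + p * + p
  +p²≡+p*+p p = trans (cong (λ k → + (p ℕ.* k)) (ℕₚ.*-identityʳ p)) (ℤ.pos-* p p)

  p*-cong : ∀ {p x y} → x ≈[ p ] y → + p * x ≈[ p ^ 2 ] + p * y
  p*-cong {p} {x} {y} x≈y =
    ∣⇒≈ (subst₂ _∣_ (sym (+p²≡+p*+p p)) (distrib (+ p) x y) (*-monoʳ-∣ (+ p) (≈⇒∣ x≈y)))
    where
    distrib : ∀ k x y → k * (x - y) ≡ k * x - k * y
    distrib = solve-∀

  ≈[p²]⇒≈[p] : ∀ {p x y} → x ≈[ p ^ 2 ] y → x ≈[ p ] y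
  ≈[p²]⇒≈[p] {p} {x} {y} x≈y with ≈⇒∣ x≈y
  ... | divides q x-y≡q*p² = ∣⇒≈ (divides (q * + p) (begin
    x - y              ≡⟨ x-y≡q*p² ⟩
    q * + (p ^ 2)      ≡⟨ cong (q *_) (+p²≡+p*+p p) ⟩
    q * (+ p * + p)    ≡⟨ ℤ.*-assoc q (+ p) (+ p) ⟨
    q * + p * + p      ∎))
    where open ≡-Reasoning

  sumFin≡sum : ∀ n (f : Fin n → ℤ) → sumFin n f ≡ sum f
  sumFin≡sum ℕ.zero    f = refl
  sumFin≡sum (ℕ.suc n) f = cong (_+_ (f zero)) (sumFin≡sum n (f ∘ suc))

  sumFin-cong : ∀ {m} n {f g : Fin n → ℤ} → (∀ i → f i ≈[ m ] g i) → sumFin n f ≈[ m ] sumFin n g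
  sumFin-cong ℕ.zero    f≈g = ≈-refl
  sumFin-cong (ℕ.suc n) f≈g = +-cong (f≈g zero) (sumFin-cong n (f≈g ∘ suc))

  module _ {n : ℕ} where

    ∙≡sum : (x y : Vect n) → x ∙ y ≡ sum (λ i → x i * y i)
    ∙≡sum x y = sumFin≡sum n _

    ∙-comm : (x y : Vect n) → x ∙ y ≡ y ∙ x
    ∙-comm x y = begin
      x ∙ y                   ≡⟨ ∙≡sum x y ⟩
      sum (λ i → x i * y i)   ≡⟨ sum-cong-≗ (λ i → ℤ.*-comm (x i) (y i)) ⟩
      sum (λ i → y i * x i)   ≡⟨ ∙≡sum y x ⟨
      y ∙ x                   ∎
      where open ≡-Reasoning

    ∙-distribˡ-+v : (x y z : Vect n) → x ∙ (y +v z) ≡ x ∙ y + x ∙ z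
    ∙-distribˡ-+v x y z = begin
      x ∙ (y +v z)                                   ≡⟨ ∙≡sum x (y +v z) ⟩
      sum (λ i → x i * (y i + z i))                  ≡⟨ sum-cong-≗ (λ i → ℤ.*-distribˡ-+ (x i) (y i) (z i)) ⟩
      sum (λ i → x i * y i + x i * z i)              ≡⟨ ∑-distrib-+ (λ i → x i * y i) (λ i → x i * z i) ⟩
      sum (λ i → x i * y i) + sum (λ i → x i * z i)  ≡⟨ cong₂ _+_ (∙≡sum x y) (∙≡sum x z) ⟨
      x ∙ y + x ∙ z                                  ∎
      where open ≡-Reasoning

    ∙-distribʳ-+v : (x y z : Vect n) → (x +v y) ∙ z ≡ x ∙ z + y ∙ z
    ∙-distribʳ-+v x y z = begin
      (x +v y) ∙ z     ≡⟨ ∙-comm (x +v y) z ⟩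
      z ∙ (x +v y)     ≡⟨ ∙-distribˡ-+v z x y ⟩
      z ∙ x + z ∙ y    ≡⟨ cong₂ _+_ (∙-comm z x) (∙-comm z y) ⟩
      x ∙ z + y ∙ z    ∎
      where open ≡-Reasoning

    ∙-·v : (x : Vect n) (a : ℤ) (y : Vect n) → x ∙ (a ·v y) ≡ a * (x ∙ y)
    ∙-·v x a y = begin
      x ∙ (a ·v y)                   ≡⟨ ∙≡sum x (a ·v y) ⟩
      sum (λ i → x i * (a * y i))    ≡⟨ sum-cong-≗ (λ i → x∙yz≈y∙xz (x i) a (y i)) ⟩
      sum (λ i → a * (x i * y i))    ≡⟨ *-distribˡ-sum a (λ i → x i * y i) ⟨
      a * sum (λ i → x i * y i)      ≡⟨ cong (a *_) (∙≡sum x y) ⟨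
      a * (x ∙ y)                    ∎
      where open ≡-Reasoning

    ∙-cong : ∀ {m} {x x′ y y′ : Vect n} → x ≈ᵛ[ m ] x′ → y ≈ᵛ[ m ] y′ → x ∙ y ≈[ m ] x′ ∙ y′
    ∙-cong x≈x′ y≈y′ = sumFin-cong n (λ i → *-cong (x≈x′ i) (y≈y′ i))

open Congruence

module Lifting where
  open import Data.Integer using (+_; -1ℤ; _+_; _*_; _-_)
  import Data.Integer.Properties as ℤ
  open import Data.Integer.Tactic.RingSolver using (solve-∀)
  open import Algebra.Properties.CommutativeSemigroup ℤ.+-commutativeSemigroup
    using () renaming (interchange to +-interchange)
  open import Algebra.Properties.CommutativeSemigroup ℤ.*-commutativeSemigroup
    using (x∙yz≈y∙xz)

  module _ {m n : ℕ} where

    ⊆-antisym : (C D : Code m n) → C ⊆ᶜ D → D ⊆ᶜ C → C ≐ᶜ D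
    ⊆-antisym C D C⊆D D⊆C x = mk⇔ (C⊆D x) (D⊆C x)

    infixl 30 _+ᶜ_
    _+ᶜ_ : Code m n → Code m n → Code m n
    C +ᶜ D = record
      { _∈_      = λ x → ∃₂ λ c d → c ∈ᶜ C × d ∈ᶜ D × x ≈ᵛ[ m ] c +v d
      ; resp     = λ { x≡y (c , d , c∈C , d∈D , x≈c+d) →
                       c , d , c∈C , d∈D , λ i → ≈-trans (≈-sym (≡[]⇒≈ (x≡y i))) (x≈c+d i) }
      ; zero∈    = 0v , 0v , zero∈ C , zero∈ D , λ _ → ≈-refl
      ; +-closed = λ { (c , d , c∈C , d∈D , x≈c+d) (c′ , d′ , c′∈C , d′∈D , y≈c′+d′) →
                       c +v c′ , d +v d′ , +-closed C c∈C c′∈C , +-closed D d∈D d′∈D ,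
                       λ i → ≈-trans (+-cong (x≈c+d i) (y≈c′+d′ i))
                                     (≈-reflexive (+-interchange (c i) (d i) (c′ i) (d′ i))) }
      ; ·-closed = λ { a (c , d , c∈C , d∈D , x≈c+d) →
                       a ·v c , a ·v d , ·-closed C a c∈C , ·-closed D a d∈D ,
                       λ i → ≈-trans (*-cong (≈-refl {x = a}) (x≈c+d i))
                                     (≈-reflexive (ℤ.*-distribˡ-+ a (c i) (d i))) }
      }

    module _ (C D : Code m n) where

      ⊆-+ᶜˡ : C ⊆ᶜ C +ᶜ D
      ⊆-+ᶜˡ c c∈C = c , 0v , c∈C , zero∈ D , λ i → ≈-reflexive (sym (ℤ.+-identityʳ (c i)))

      ⊆-+ᶜʳ : D ⊆ᶜ C +ᶜ D
      ⊆-+ᶜʳ d d∈D = 0v , d , zero∈ C , d∈D , λ i → ≈-reflexive (sym (ℤ.+-identityˡ (d i)))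

      +ᶜ-least : (E : Code m n) → C ⊆ᶜ E → D ⊆ᶜ E → C +ᶜ D ⊆ᶜ E
      +ᶜ-least E C⊆E D⊆E x (c , d , c∈C , d∈D , x≈c+d) =
        resp E (λ i → ≈⇒≡[] (≈-sym (x≈c+d i))) (+-closed E (C⊆E c c∈C) (D⊆E d d∈D))

      +ᶜ-selfOrthogonal : SelfOrthogonal C → SelfOrthogonal D → D ⊆⊥ C → SelfOrthogonal (C +ᶜ D)
      +ᶜ-selfOrthogonal C-so D-so D⊥C
        x (c , d , c∈C , d∈D , x≈c+d) y (c′ , d′ , c′∈C , d′∈D , y≈c′+d′) = ≈⇒≡[] (begin
        y ∙ x                                  ≈⟨ ∙-cong y≈c′+d′ x≈c+d ⟩
        (c′ +v d′) ∙ (c +v d)                  ≡⟨ ∙-distribʳ-+v c′ d′ (c +v d) ⟩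
        c′ ∙ (c +v d) + d′ ∙ (c +v d)          ≡⟨ cong₂ _+_ (∙-distribˡ-+v c′ c d) (∙-distribˡ-+v d′ c d) ⟩
        (c′ ∙ c + c′ ∙ d) + (d′ ∙ c + d′ ∙ d)  ≈⟨ +-cong (+-cong c′∙c≈0 c′∙d≈0) (+-cong d′∙c≈0 d′∙d≈0) ⟩
        + 0                                    ∎)
        where
        open ≈-Reasoning m
        c′∙c≈0 : c′ ∙ c ≈[ m ] + 0
        c′∙c≈0 = ≡[]⇒≈ (C-so c c∈C c′ c′∈C)
        c′∙d≈0 : c′ ∙ d ≈[ m ] + 0
        c′∙d≈0 = ≡[]⇒≈ (D⊥C d d∈D c′ c′∈C)
        d′∙c≈0 : d′ ∙ c ≈[ m ] + 0
        d′∙c≈0 = ≈-trans (≈-reflexive (∙-comm d′ c)) (≡[]⇒≈ (D⊥C d′ d′∈D c c∈C))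
        d′∙d≈0 : d′ ∙ d ≈[ m ] + 0
        d′∙d≈0 = ≡[]⇒≈ (D-so d d∈D d′ d′∈D)

  module _ {p n : ℕ} where

    ι[_] : Code p n → Code (p ^ 2) n
    ι[ D ] = record
      { _∈_      = λ x → ∃ λ z → z ∈ᶜ D × x ≈ᵛ[ p ^ 2 ] (+ p) ·v z
      ; resp     = λ { x≡y (z , z∈D , x≈pz) →
                       z , z∈D , λ i → ≈-trans (≈-sym (≡[]⇒≈ (x≡y i))) (x≈pz i) }
      ; zero∈    = 0v , zero∈ D , λ _ → ≈-reflexive (sym (ℤ.*-zeroʳ (+ p)))
      ; +-closed = λ { (z , z∈D , x≈pz) (z′ , z′∈D , y≈pz′) →
                       z +v z′ , +-closed D z∈D z′∈D ,
                       λ i → ≈-trans (+-cong (x≈pz i) (y≈pz′ i))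
                                     (≈-reflexive (sym (ℤ.*-distribˡ-+ (+ p) (z i) (z′ i)))) }
      ; ·-closed = λ { a (z , z∈D , x≈pz) →
                       a ·v z , ·-closed D a z∈D ,
                       λ i → ≈-trans (*-cong (≈-refl {x = a}) (x≈pz i))
                                     (≈-reflexive (x∙yz≈y∙xz a (+ p) (z i))) }
      }

    ∈-ι[] : (D : Code p n) → ∀ z → z ∈ᶜ D → ((+ p) ·v z) ∈ᶜ ι[ D ]
    ∈-ι[] D z z∈D = z , z∈D , λ _ → ≈-refl

    ι[]-⊆ : (C : Code (p ^ 2) n) (D : Code p n) → (∀ z → z ∈ᶜ D → _∈ι⁻¹_ {p} z C) → ι[ D ] ⊆ᶜ C
    ι[]-⊆ C D D⊆ι⁻¹C x (z , z∈D , x≈pz) = resp C (λ i → ≈⇒≡[] (≈-sym (x≈pz i))) (D⊆ι⁻¹C z z∈D)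

    ι[]-selfOrthogonal : (D : Code p n) → SelfOrthogonal ι[ D ]
    ι[]-selfOrthogonal D x (z , _ , x≈pz) y (z′ , _ , y≈pz′) = ≈⇒≡[] (begin
      y ∙ x                            ≈⟨ ∙-cong y≈pz′ x≈pz ⟩
      ((+ p) ·v z′) ∙ ((+ p) ·v z)     ≡⟨ ∙-·v ((+ p) ·v z′) (+ p) z ⟩
      + p * (((+ p) ·v z′) ∙ z)        ≈⟨ p*-cong pz′∙z≈0 ⟩
      + p * + 0                        ≡⟨ ℤ.*-zeroʳ (+ p) ⟩
      + 0                              ∎)
      where
      open ≈-Reasoning (p ^ 2)
      pz′∙z≈0 : ((+ p) ·v z′) ∙ z ≈[ p ] + 0
      pz′∙z≈0 = ≈-trans (≈-reflexive (trans (∙-comm ((+ p) ·v z′) z) (∙-·v z (+ p) z′)))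
                        (multiple≈0 (z ∙ z′))

    ι[]-⊆⊥ : (C : Code (p ^ 2) n) (D E : Code p n) → πEq C E → D ⊆⊥ E → ι[ D ] ⊆⊥ C
    ι[]-⊆⊥ C D E πC D⊥E x (z , z∈D , x≈pz) y y∈C = ≈⇒≡[] (begin
      y ∙ x                ≈⟨ ∙-cong (λ i → ≈-refl {x = y i}) x≈pz ⟩
      y ∙ ((+ p) ·v z)     ≡⟨ ∙-·v y (+ p) z ⟩
      + p * (y ∙ z)        ≈⟨ p*-cong (≡[]⇒≈ (D⊥E z z∈D y y∈E)) ⟩
      + p * + 0            ≡⟨ ℤ.*-zeroʳ (+ p) ⟩
      + 0                  ∎)
      where
      open ≈-Reasoning (p ^ 2)
      y∈E : y ∈ᶜ E
      y∈E = to (πC y) (y , y∈C , λ i → ≈⇒≡[] (≈-refl {x = y i}))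

    πEq-+ᶜι[] : (C : Code (p ^ 2) n) (D E : Code p n) → πEq C E → πEq (C +ᶜ ι[ D ]) E
    πEq-+ᶜι[] C D E πC x = mk⇔ reduce lift
      where
      reduce : _∈π_ {p} x (C +ᶜ ι[ D ]) → x ∈ᶜ E
      reduce (y , (c , w , c∈C , (z , _ , w≈pz) , y≈c+w) , x≡y) =
        to (πC x) (c , c∈C , λ i → ≈⇒≡[] (x≈c i))
        where
        open ≈-Reasoning p
        x≈c : x ≈ᵛ[ p ] c
        x≈c i = begin
          x i              ≈⟨ ≡[]⇒≈ (x≡y i) ⟩
          y i              ≈⟨ ≈[p²]⇒≈[p] (y≈c+w i) ⟩
          c i + w i        ≈⟨ +-cong (≈-refl {x = c i}) (≈[p²]⇒≈[p] (w≈pz i)) ⟩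
          c i + + p * z i  ≈⟨ +-cong (≈-refl {x = c i}) (multiple≈0 (z i)) ⟩
          c i + + 0        ≡⟨ ℤ.+-identityʳ (c i) ⟩
          c i              ∎
      lift : x ∈ᶜ E → _∈π_ {p} x (C +ᶜ ι[ D ])
      lift x∈E with from (πC x) x∈E
      ... | y , y∈C , x≡y = y , ⊆-+ᶜˡ C ι[ D ] y y∈C , x≡y

    ι⁻¹Eq-+ᶜι[] : (C : Code (p ^ 2) n) (D : Code p n)
                → (∀ x → _∈ι⁻¹_ {p} x C → x ∈ᶜ D) → ι⁻¹Eq (C +ᶜ ι[ D ]) D
    ι⁻¹Eq-+ᶜι[] C D ι⁻¹C⊆D x = mk⇔ reduce lift
      where
      reduce : _∈ι⁻¹_ {p} x (C +ᶜ ι[ D ]) → x ∈ᶜ D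
      reduce (c , w , c∈C , (z , z∈D , w≈pz) , px≈c+w) =
        resp D (λ i → ≈⇒≡[] (≈-reflexive (x-z+z (x i) (z i)))) (+-closed D v∈D z∈D)
        where
        open ≈-Reasoning (p ^ 2)
        c+w-w : ∀ c w → c ≡ (c + w) - w
        c+w-w = solve-∀
        factor : ∀ k x z → k * x - k * z ≡ k * (x - z)
        factor = solve-∀
        x-z+z : ∀ x z → (x - z) + z ≡ x
        x-z+z = solve-∀
        v : Vect n
        v i = x i - z i
        c≈pv : c ≈ᵛ[ p ^ 2 ] (+ p) ·v v
        c≈pv i = begin
          c i                        ≡⟨ c+w-w (c i) (w i) ⟩
          (c i + w i) - w i          ≈⟨ +-cong (≈-sym (px≈c+w i)) (-‿cong (w≈pz i)) ⟩
          + p * x i - + p * z i      ≡⟨ factor (+ p) (x i) (z i) ⟩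
          + p * (x i - z i)          ∎
        v∈D : v ∈ᶜ D
        v∈D = ι⁻¹C⊆D v (resp C (λ i → ≈⇒≡[] (c≈pv i)) c∈C)
      lift : x ∈ᶜ D → _∈ι⁻¹_ {p} x (C +ᶜ ι[ D ])
      lift x∈D = ⊆-+ᶜʳ C ι[ D ] ((+ p) ·v x) (∈-ι[] D x x∈D)

    +ᶜι[]-unique : (C C″ : Code (p ^ 2) n) (D E : Code p n)
                 → πEq C E → πEq C″ E → ι⁻¹Eq C″ D → C ⊆ᶜ C″ → C″ ≐ᶜ C +ᶜ ι[ D ]
    +ᶜι[]-unique C C″ D E πC πC″ ι⁻¹C″ C⊆C″ =
      ⊆-antisym C″ (C +ᶜ ι[ D ]) C″⊆C+ι[D]
        (+ᶜ-least C ι[ D ] C″ C⊆C″ (ι[]-⊆ C″ D (λ z → from (ι⁻¹C″ z))))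
      where
      C″⊆C+ι[D] : C″ ⊆ᶜ C +ᶜ ι[ D ]
      C″⊆C+ι[D] x x∈C″ with from (πC x) (to (πC″ x) (x , x∈C″ , λ i → ≈⇒≡[] (≈-refl {x = x i})))
      ... | c , c∈C , x≡c =
        c , (+ p) ·v w , c∈C , ∈-ι[] D w w∈D , λ i → ≈-reflexive (proj₂ (quotient i))
        where
        quotient : ∀ i → ∃ λ k → x i ≡ c i + + p * k
        quotient i = ≈⇒quotient (≡[]⇒≈ (x≡c i))
        w : Vect n
        w = proj₁ ∘ quotient
        cancel : ∀ c d → (c + d) + -1ℤ * c ≡ d
        cancel = solve-∀
        x-c≡pw : ∀ i → x i + -1ℤ * c i ≡ + p * w i
        x-c≡pw i = begin
          x i + -1ℤ * c i                  ≡⟨ cong (λ t → t + -1ℤ * c i) (proj₂ (quotient i)) ⟩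
          (c i + + p * w i) + -1ℤ * c i    ≡⟨ cancel (c i) (+ p * w i) ⟩
          + p * w i                        ∎
          where open ≡-Reasoning
        w∈D : w ∈ᶜ D
        w∈D = to (ι⁻¹C″ w) (resp C″ (λ i → ≈⇒≡[] (≈-reflexive (x-c≡pw i)))
                                    (+-closed C″ x∈C″ (·-closed C″ -1ℤ (C⊆C″ c c∈C))))

open Lifting
-- Imported only now: the modules above use ℤ's _+_ unqualified.
open import Data.Nat using (_+_)

lemma4p3 : (p : ℕ) → Prime p → (k₁ k₂ r : ℕ)
    → (A : Fin k₁ → Fin r → ℤ) → (B : Fin k₂ → Fin r → ℤ)
    → (C₁ C₂ : Code p (k₁ + r))
    → C₁ ⊆ᶜ C₂ → C₂ ⊆⊥ C₁
    → IsGenerator [I∣ A ] C₁ → IsGenerator [I∣ A ⁄0∣ B ] C₂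
    → HasDim C₁ k₁ → HasDim C₂ (k₁ + k₂)
    → DoublyEvenIf2 C₁
    → (C : Code (p ^ 2) (k₁ + r)) → InX C₁ C
    → Σ (Code (p ^ 2) (k₁ + r)) λ C' → InX' C₁ C₂ C' × C ⊆ᶜ C'
        × ((C'' : Code (p ^ 2) (k₁ + r)) → InX' C₁ C₂ C'' → C ⊆ᶜ C'' → C'' ≐ᶜ C')
lemma4p3 p _ k₁ k₂ r A B C₁ C₂ C₁⊆C₂ C₂⊥C₁ _ _ _ _ _ C (C-so , πC , ι⁻¹C) =
  C +ᶜ ι[ C₂ ] ,
  (C′-so , πEq-+ᶜι[] C C₂ C₁ πC , ι⁻¹Eq-+ᶜι[] C C₂ ι⁻¹C⊆C₂) ,
  ⊆-+ᶜˡ C ι[ C₂ ] ,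
  λ C″ (_ , πC″ , ι⁻¹C″) → +ᶜι[]-unique C C″ C₂ C₁ πC πC″ ι⁻¹C″
  where
  ι⁻¹C⊆C₂ : ∀ x → _∈ι⁻¹_ {p} x C → x ∈ᶜ C₂
  ι⁻¹C⊆C₂ x x∈ι⁻¹C = C₁⊆C₂ x (to (ι⁻¹C x) x∈ι⁻¹C)
  C′-so : SelfOrthogonal (C +ᶜ ι[ C₂ ])
  C′-so = +ᶜ-selfOrthogonal C ι[ C₂ ] C-so (ι[]-selfOrthogonal C₂) (ι[]-⊆⊥ C C₂ C₁ πC C₂⊥C₁)
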